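{- Let $s,t \geq 1$ be integers and let $\beta_{s,t}$ be the type-$\beta$ comb with $s$ teeth of length $t$. Then exactly one linear extension of $\beta_{s,t}$ avoids both patterns $213$ and $231$.
   Context: A linear extension of a finite poset $P$ on a set of integers is a listing $v=[v_1,\dots,v_n]$ of all elements of $P$, each exactly once, such that whenever $a \leq_P b$, $a$ appears before $b$. For $w \in S_3$, a sequence $v$ of distinct integers contains $w$ if there are indices $i<j<k$ with $(v_i,v_j,v_k)$ in the same relative order as $(w_1,w_2,w_3)$; otherwise $v$ avoids $w$. The type-$\beta$ comb $\beta_{s,t}$ is the poset on $\{1,\dots,st\}$ whose order is generated by the relations $ct+1 \leq (c+1)t+1$ for $0 \leq c \leq s-2$ (the spine) and $ct+j \leq ct+j+1$ for $0 \leq c \leq s-1$, $1 \leq j \leq t-1$ (the teeth $\{ct+1,\dots,ct+t\}$). -}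

module Defs where

open import Data.Nat using (ℕ; zero; suc; _+_; _*_; _<_; _≤_)
open import Data.List using (List; []; _∷_; length; lookup; map; upTo)
open import Data.Fin using (Fin; toℕ)
open import Data.Product using (_×_; ∃-syntax)
open import Data.Vec using (Vec; _∷_; [])
import Data.Vec as V
open import Function.Bundles using (_⇔_)
open import Data.List.Relation.Binary.Permutation.Propositional using (_↭_)
open import Relation.Nullary using (¬_)
open import Relation.Binary.Construct.Closure.ReflexiveTransitive using (Star)

data CombGen (s t : ℕ) : ℕ → ℕ → Set where
  spine : (c : ℕ) → suc c < s → CombGen s t (c * t + 1) (suc c * t + 1)
  tooth : (c j : ℕ) → c < s → 1 ≤ j → j < t → CombGen s t (c * t + j) (c * t + suc j)

_≤β[_,_]_ : ℕ → ℕ → ℕ → ℕ → Set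
a ≤β[ s , t ] b = Star (CombGen s t) a b

ground : ℕ → ℕ → List ℕ
ground s t = map suc (upTo (s * t))

IsLinearExtension : ℕ → ℕ → List ℕ → Set
IsLinearExtension s t v =
  (v ↭ ground s t) ×
  ((i j : Fin (length v)) → lookup v i ≤β[ s , t ] lookup v j → toℕ i ≤ toℕ j)

SameOrder : Vec ℕ 3 → Vec ℕ 3 → Set
SameOrder x w = (p q : Fin 3) → (V.lookup x p < V.lookup x q) ⇔ (V.lookup w p < V.lookup w q)

Contains : Vec ℕ 3 → List ℕ → Set
Contains w v = ∃[ i ] ∃[ j ] ∃[ k ]
  (toℕ {length v} i < toℕ j × toℕ j < toℕ k ×
   SameOrder (lookup v i ∷ lookup v j ∷ lookup v k ∷ []) w)

Avoids : Vec ℕ 3 → List ℕ → Set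
Avoids w v = ¬ Contains w v

p213 : Vec ℕ 3
p213 = 2 ∷ 1 ∷ 3 ∷ []

p231 : Vec ℕ 3
p231 = 2 ∷ 3 ∷ 1 ∷ []

-- A sequence avoiding both 213 and 231 has no entry lying strictly between
-- two later entries, so each entry is the least or the greatest of what
-- remains.  For a permutation of {1,…,N} the first entry is therefore 1 or N,
-- and in a linear extension it cannot be N when N ≥ 2, because N − 1 ≤ N in
-- the comb (along the last tooth, or along the spine when t = 1).  Peeling
-- off the first entry and repeating forces the identity 1 2 ⋯ N, which is a
-- linear extension (every covering relation increases) avoiding both patterns.
module Submission where

open import Defs
open import Data.Nat using (ℕ; zero; suc; pred; z<s; _+_; _*_; _≤_; _<_; z≤n; s≤s; _≟_; _<?_)
open import Data.Nat.Properties
open import Data.List using (List; []; _∷_; length; lookup; applyUpTo)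
open import Data.List.Properties using (map-upTo)
open import Data.List.Membership.Propositional using (_∈_)
open import Data.List.Relation.Unary.Any using (here; there; index)
open import Data.List.Relation.Unary.Any.Properties using (lookup-index)
open import Data.List.Relation.Binary.Permutation.Propositional using (_↭_; ↭-refl; ↭-sym)
open import Data.List.Relation.Binary.Permutation.Propositional.Properties
  using (↭-empty-inv; ¬x∷xs↭[]; ∈-resp-↭; drop-∷)
open import Data.Fin using (Fin; toℕ; zero; suc)
open import Data.Fin.Properties using (toℕ-injective)
open import Data.Product using (_×_; _,_; proj₁; proj₂; ∃!)
open import Data.Sum using (_⊎_; inj₁; inj₂; [_,_]′)
open import Data.Vec using (_∷_; [])
import Data.Vec as V
open import Data.Empty using (⊥-elim)
open import Function using (_∘′_)
open import Function.Bundles using (_⇔_; mk⇔; Equivalence)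
open import Relation.Nullary using (¬_; yes; no)
open import Relation.Nullary.Decidable using (False; toWitnessFalse)
open import Relation.Binary using (tri<; tri≈; tri>)
open import Relation.Binary.PropositionalEquality
  using (_≡_; _≢_; refl; sym; trans; cong; cong₂; subst; subst₂)
open import Relation.Binary.Construct.Closure.ReflexiveTransitive using (ε; _◅_)

interval : ℕ → ℕ → List ℕ
interval k zero    = []
interval k (suc m) = suc k ∷ interval (suc k) m

applyUpTo≡interval : ∀ (f : ℕ → ℕ) k m → (∀ i → f i ≡ suc (k + i)) → applyUpTo f m ≡ interval k m
applyUpTo≡interval f k zero    f≗ = refl
applyUpTo≡interval f k (suc m) f≗ =
  cong₂ _∷_ (trans (f≗ 0) (cong suc (+-identityʳ k)))
            (applyUpTo≡interval (λ i → f (suc i)) (suc k) m (λ i → trans (f≗ (suc i)) (cong suc (+-suc k i))))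

ground≡interval : ∀ s t → ground s t ≡ interval 0 (s * t)
ground≡interval s t = trans (map-upTo suc (s * t)) (applyUpTo≡interval suc 0 (s * t) (λ i → refl))

lookup-interval : ∀ k m (i : Fin (length (interval k m))) → lookup (interval k m) i ≡ suc (k + toℕ i)
lookup-interval k (suc m) zero    = cong suc (sym (+-identityʳ k))
lookup-interval k (suc m) (suc i) = trans (lookup-interval (suc k) m i) (cong suc (sym (+-suc k (toℕ i))))

∈-interval⁻ : ∀ {x} k m → x ∈ interval k m → k < x × x ≤ k + m
∈-interval⁻ k (suc m) (here refl) = ≤-refl , subst (suc k ≤_) (sym (+-suc k m)) (s≤s (m≤m+n k m))
∈-interval⁻ {x} k (suc m) (there x∈) with ∈-interval⁻ (suc k) m x∈
... | k<x , x≤ = <-trans (n<1+n k) k<x , subst (x ≤_) (sym (+-suc k m)) x≤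

∈-interval⁺ : ∀ {x} k m → k < x → x ≤ k + m → x ∈ interval k m
∈-interval⁺ {x} k zero    k<x x≤ = ⊥-elim (<⇒≱ k<x (subst (x ≤_) (+-identityʳ k) x≤))
∈-interval⁺ {x} k (suc m) k<x x≤ with x ≟ suc k
... | yes refl = here refl
... | no x≢ = there (∈-interval⁺ (suc k) m (≤∧≢⇒< k<x (x≢ ∘′ sym)) (subst (x ≤_) (+-suc k m) x≤))

CombGen-increasing : ∀ {s t a b} → 1 ≤ t → CombGen s t a b → a < b
CombGen-increasing {t = t} 1≤t (spine c _)       =
  +-monoˡ-< 1 (subst (c * t <_) (+-comm (c * t) t) (m<m+n (c * t) 1≤t))
CombGen-increasing {t = t} 1≤t (tooth c j _ _ _) =
  +-monoʳ-< (c * t) (n<1+n j)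

≤β⇒≤ : ∀ {s t a b} → 1 ≤ t → a ≤β[ s , t ] b → a ≤ b
≤β⇒≤ 1≤t ε          = ≤-refl
≤β⇒≤ 1≤t (gen ◅ a≤b) = ≤-trans (<⇒≤ (CombGen-increasing 1≤t gen)) (≤β⇒≤ 1≤t a≤b)

pred≤βtop : ∀ s t → 1 ≤ s → 1 ≤ t → 2 ≤ s * t → pred (s * t) ≤β[ s , t ] (s * t)
pred≤βtop (suc s′) t@(suc (suc t″)) _ _ _ =
  subst₂ (CombGen (suc s′) t) (+-comm (s′ * t) (suc t″)) (+-comm (s′ * t) t)
    (tooth s′ (suc t″) (n<1+n s′) (s≤s z≤n) (n<1+n (suc t″)))
  ◅ ε
pred≤βtop (suc (suc s″)) 1 _ _ _ =
  subst₂ (CombGen (suc (suc s″)) 1) (+-comm (s″ * 1) 1) (+-comm (suc s″ * 1) 1)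
    (spine s″ (n<1+n (suc s″)))
  ◅ ε
pred≤βtop 1 1 _ _ (s≤s ())

Precedes : ℕ → ℕ → List ℕ → Set
Precedes a b v = (i j : Fin (length v)) → lookup v i ≡ a → lookup v j ≡ b → toℕ i ≤ toℕ j

Precedes-tail : ∀ {a b x xs} → Precedes a b (x ∷ xs) → Precedes a b xs
Precedes-tail a≺b i j vᵢ≡a vⱼ≡b = ≤-pred (a≺b (suc i) (suc j) vᵢ≡a vⱼ≡b)

linearExtension⇒Precedes : ∀ {s t a b v} → IsLinearExtension s t v → a ≤β[ s , t ] b → Precedes a b v
linearExtension⇒Precedes {s} {t} (_ , respects) a≤b i j vᵢ≡a vⱼ≡b =
  respects i j (subst₂ (λ a b → a ≤β[ s , t ] b) (sym vᵢ≡a) (sym vⱼ≡b) a≤b)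

⇔-both : ∀ {P Q : Set} → P → Q → P ⇔ Q
⇔-both p q = mk⇔ (λ _ → q) (λ _ → p)

⇔-neither : ∀ {P Q : Set} → ¬ P → ¬ Q → P ⇔ Q
⇔-neither ¬p ¬q = mk⇔ (⊥-elim ∘′ ¬p) (⊥-elim ∘′ ¬q)

-- refutes a strict inequality between numerals by evaluation
≮ : ∀ {m n} {m≮n : False (m <? n)} → ¬ m < n
≮ {m≮n = m≮n} = toWitnessFalse m≮n

sameOrder-213 : ∀ {a b c} → b < a → a < c → SameOrder (a ∷ b ∷ c ∷ []) p213
sameOrder-213 b<a a<c = λ where
  zero             zero             → ⇔-neither (<-irrefl refl) ≮
  zero             (suc zero)       → ⇔-neither (<-asym b<a) ≮
  zero             (suc (suc zero)) → ⇔-both a<c (s≤s (s≤s (s≤s z≤n)))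
  (suc zero)       zero             → ⇔-both b<a (s≤s (s≤s z≤n))
  (suc zero)       (suc zero)       → ⇔-neither (<-irrefl refl) ≮
  (suc zero)       (suc (suc zero)) → ⇔-both (<-trans b<a a<c) (s≤s (s≤s z≤n))
  (suc (suc zero)) zero             → ⇔-neither (<-asym a<c) ≮
  (suc (suc zero)) (suc zero)       → ⇔-neither (<-asym (<-trans b<a a<c)) ≮
  (suc (suc zero)) (suc (suc zero)) → ⇔-neither (<-irrefl refl) ≮

sameOrder-231 : ∀ {a b c} → c < a → a < b → SameOrder (a ∷ b ∷ c ∷ []) p231
sameOrder-231 c<a a<b = λ where
  zero             zero             → ⇔-neither (<-irrefl refl) ≮
  zero             (suc zero)       → ⇔-both a<b (s≤s (s≤s (s≤s z≤n)))
  zero             (suc (suc zero)) → ⇔-neither (<-asym c<a) ≮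
  (suc zero)       zero             → ⇔-neither (<-asym a<b) ≮
  (suc zero)       (suc zero)       → ⇔-neither (<-irrefl refl) ≮
  (suc zero)       (suc (suc zero)) → ⇔-neither (<-asym (<-trans c<a a<b)) ≮
  (suc (suc zero)) zero             → ⇔-both c<a (s≤s (s≤s z≤n))
  (suc (suc zero)) (suc zero)       → ⇔-both (<-trans c<a a<b) (s≤s (s≤s z≤n))
  (suc (suc zero)) (suc (suc zero)) → ⇔-neither (<-irrefl refl) ≮

Contains-∷ : ∀ {w x xs} → Contains w xs → Contains w (x ∷ xs)
Contains-∷ (i , j , k , i<j , j<k , order) = suc i , suc j , suc k , s≤s i<j , s≤s j<k , order

Avoids-tail : ∀ {w x xs} → Avoids w (x ∷ xs) → Avoids w xs
Avoids-tail {w} avoids = avoids ∘′ Contains-∷ {w}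

between-head⇒213⊎231 : ∀ {x xs y z} → y ∈ xs → z ∈ xs → y < x → x < z →
  Contains p213 (x ∷ xs) ⊎ Contains p231 (x ∷ xs)
between-head⇒213⊎231 {x} {xs} {y} {z} y∈ z∈ y<x x<z with <-cmp (toℕ (index y∈)) (toℕ (index z∈))
... | tri< y-first _ _ = inj₁ (zero , suc (index y∈) , suc (index z∈) , z<s , s≤s y-first ,
        subst₂ (λ u v → SameOrder (x ∷ u ∷ v ∷ []) p213) (lookup-index y∈) (lookup-index z∈)
               (sameOrder-213 y<x x<z))
... | tri> _ _ z-first = inj₂ (zero , suc (index z∈) , suc (index y∈) , z<s , s≤s z-first ,
        subst₂ (λ u v → SameOrder (x ∷ u ∷ v ∷ []) p231) (lookup-index z∈) (lookup-index y∈)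
               (sameOrder-231 y<x x<z))
... | tri≈ _ same _ = ⊥-elim (<-irrefl y≡z (<-trans y<x x<z))
  where
  y≡z : y ≡ z
  y≡z = trans (lookup-index y∈) (trans (cong (lookup xs) (toℕ-injective same)) (sym (lookup-index z∈)))

∈-↭-tail : ∀ {x y : ℕ} {xs ys} → x ∷ xs ↭ ys → y ∈ ys → y ≢ x → y ∈ xs
∈-↭-tail x∷xs↭ys y∈ys y≢x with ∈-resp-↭ (↭-sym x∷xs↭ys) y∈ys
... | here y≡x = ⊥-elim (y≢x y≡x)
... | there y∈xs = y∈xs

head-of-interval-extremal : ∀ {k m x xs} → x ∷ xs ↭ interval k (suc m) →
  Avoids p213 (x ∷ xs) → Avoids p231 (x ∷ xs) → x ≡ suc k ⊎ x ≡ k + suc m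
head-of-interval-extremal {k} {m} {x} {xs} x∷xs↭ avoids-213 avoids-231 with x ≟ suc k | x ≟ k + suc m
... | yes x≡min | _         = inj₁ x≡min
... | no _      | yes x≡max = inj₂ x≡max
... | no x≢min  | no x≢max  =
  ⊥-elim ([ avoids-213 , avoids-231 ]′ (between-head⇒213⊎231 min∈ max∈ min<x x<max))
  where
  x-bounds : k < x × x ≤ k + suc m
  x-bounds = ∈-interval⁻ k (suc m) (∈-resp-↭ x∷xs↭ (here refl))
  min∈ : suc k ∈ xs
  min∈ = ∈-↭-tail x∷xs↭ (here refl) (x≢min ∘′ sym)
  max∈ : k + suc m ∈ xs
  max∈ = ∈-↭-tail x∷xs↭ (∈-interval⁺ k (suc m) (m<m+n k z<s) ≤-refl) (x≢max ∘′ sym)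
  min<x : suc k < x
  min<x = ≤∧≢⇒< (proj₁ x-bounds) (x≢min ∘′ sym)
  x<max : x < k + suc m
  x<max = ≤∧≢⇒< (proj₂ x-bounds) x≢max

head-of-interval : ∀ {k m x xs} → x ∷ xs ↭ interval k (suc m) →
  Avoids p213 (x ∷ xs) → Avoids p231 (x ∷ xs) →
  (2 ≤ k + suc m → Precedes (pred (k + suc m)) (k + suc m) (x ∷ xs)) → x ≡ suc k
head-of-interval x∷xs↭ avoids-213 avoids-231 _
  with head-of-interval-extremal x∷xs↭ avoids-213 avoids-231
... | inj₁ x≡min = x≡min
head-of-interval {k} {zero}   _ _ _ _       | inj₂ x≡max = trans x≡max (+-comm k 1)
head-of-interval {k} {suc m} {x} {xs} x∷xs↭ _ _ penultimate≺max | inj₂ x≡max =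
  ⊥-elim (n≮0 (penultimate≺max 2≤max (suc (index penultimate∈)) zero penultimate-at x≡max))
  where
  2≤max : 2 ≤ k + suc (suc m)
  2≤max = ≤-trans (s≤s (s≤s z≤n)) (m≤n+m (suc (suc m)) k)
  penultimate∈ : k + suc m ∈ xs
  penultimate∈ = ∈-↭-tail x∷xs↭
    (∈-interval⁺ k (suc (suc m)) (m<m+n k z<s) (+-monoʳ-≤ k (n≤1+n (suc m))))
    (λ penultimate≡x → <-irrefl (trans penultimate≡x x≡max) (+-monoʳ-< k (n<1+n (suc m))))
  penultimate-at : lookup xs (index penultimate∈) ≡ pred (k + suc (suc m))
  penultimate-at = trans (sym (lookup-index penultimate∈)) (sym (cong pred (+-suc k (suc m))))

interval-unique : ∀ {N} k m {w} → k + m ≡ N → w ↭ interval k m →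
  Avoids p213 w → Avoids p231 w → (2 ≤ N → Precedes (pred N) N w) → w ≡ interval k m
interval-unique k zero          _    w↭ _ _ _ = ↭-empty-inv w↭
interval-unique k (suc m) {[]}  _    w↭ _ _ _ = ⊥-elim (¬x∷xs↭[] (↭-sym w↭))
interval-unique k (suc m) {x ∷ xs} refl w↭ avoids-213 avoids-231 penultimate≺max
  with refl ← head-of-interval w↭ avoids-213 avoids-231 penultimate≺max =
  cong (suc k ∷_) (interval-unique (suc k) m (sym (+-suc k m)) (drop-∷ w↭)
    (Avoids-tail {p213} avoids-213) (Avoids-tail {p231} avoids-231) (Precedes-tail ∘′ penultimate≺max))

Increasing : List ℕ → Set
Increasing v = (i j : Fin (length v)) → toℕ i < toℕ j → lookup v i < lookup v j

interval-increasing : ∀ k m → Increasing (interval k m)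
interval-increasing k m i j i<j rewrite lookup-interval k m i | lookup-interval k m j =
  s≤s (+-monoʳ-< k i<j)

Increasing⇒contains-ascending : ∀ {v w} → Increasing v → Contains w v →
  V.lookup w zero < V.lookup w (suc zero) × V.lookup w (suc zero) < V.lookup w (suc (suc zero))
Increasing⇒contains-ascending increasing (i , j , k , i<j , j<k , order) =
  Equivalence.to (order zero (suc zero)) (increasing i j i<j) ,
  Equivalence.to (order (suc zero) (suc (suc zero))) (increasing j k j<k)

Increasing⇒avoids-213 : ∀ {v} → Increasing v → Avoids p213 v
Increasing⇒avoids-213 {v} increasing = ≮ ∘′ proj₁ ∘′ Increasing⇒contains-ascending {v} {p213} increasing

Increasing⇒avoids-231 : ∀ {v} → Increasing v → Avoids p231 v
Increasing⇒avoids-231 {v} increasing = ≮ ∘′ proj₂ ∘′ Increasing⇒contains-ascending {v} {p231} increasing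

interval-linearExtension : ∀ s t → 1 ≤ t → IsLinearExtension s t (interval 0 (s * t))
interval-linearExtension s t 1≤t =
  subst (interval 0 (s * t) ↭_) (sym (ground≡interval s t)) ↭-refl , respects
  where
  v : List ℕ
  v = interval 0 (s * t)
  respects : ∀ i j → lookup v i ≤β[ s , t ] lookup v j → toℕ i ≤ toℕ j
  respects i j vᵢ≤vⱼ rewrite lookup-interval 0 (s * t) i | lookup-interval 0 (s * t) j =
    ≤-pred (≤β⇒≤ 1≤t vᵢ≤vⱼ)

theorem17 : (s t : ℕ) → 1 ≤ s → 1 ≤ t →
    ∃! _≡_ (λ (v : List ℕ) → IsLinearExtension s t v × Avoids p213 v × Avoids p231 v)
theorem17 s t 1≤s 1≤t =
  ground s t ,
  subst Valid (sym ground≡) (interval-linearExtension s t 1≤t ,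
                              Increasing⇒avoids-213 {interval 0 (s * t)} increasing ,
                              Increasing⇒avoids-231 {interval 0 (s * t)} increasing) ,
  λ { (linear@(v↭ , _) , avoids-213 , avoids-231) →
      trans ground≡ (sym (interval-unique 0 (s * t) refl (subst (_ ↭_) ground≡ v↭) avoids-213 avoids-231
                            (linearExtension⇒Precedes linear ∘′ pred≤βtop s t 1≤s 1≤t))) }
  where
  Valid : List ℕ → Set
  Valid v = IsLinearExtension s t v × Avoids p213 v × Avoids p231 v
  ground≡ : ground s t ≡ interval 0 (s * t)
  ground≡ = ground≡interval s t
  increasing : Increasing (interval 0 (s * t))
  increasing = interval-increasing 0 (s * t)
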